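{- Let $n\ge 3$, let $\overrightarrow{C_n}$ be an oriented cycle and $D$ a nonempty set of finite distances of $\overrightarrow{C_n}$ with $\min(D)\ge 2$. If $\overrightarrow{C_n}$ is $D$-antimagic, then $\overrightarrow{C_n}$ is unidirectional.
   Context: An oriented cycle is an orientation of the cycle on vertices $v_1,\dots,v_n$. It is unidirectional if (for a suitable labeling) its arcs are $(v_i,v_{i+1})$, $1\le i\le n-1$, and $(v_n,v_1)$. $d(u,y)$ is the length of a shortest directed path from $u$ to $y$ ($d(u,u)=0$, $\infty$ if none). $N_D(v)=\{y:d(v,y)\in D\}$; a bijection $f:V\to\{1,\dots,n\}$ is $D$-antimagic if $\omega_D(v)=\sum_{y\in N_D(v)}f(y)$ are pairwise distinct; the graph is $D$-antimagic if such a bijection exists. -}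

module Defs where

open import Data.Nat using (ℕ; zero; suc; _≤_; NonZero)
open import Data.Nat.DivMod using (_%_; m%n<n)
open import Data.Fin using (Fin; toℕ; fromℕ<; _≟_)
open import Data.Bool using (Bool; true; false; _∧_; _∨_; not; if_then_else_)
open import Data.List using (List; []; allFin; map)
open import Data.Bool.ListAction using (any)
open import Data.Nat.ListAction using (sum)
open import Data.List.Relation.Unary.All using (All)
open import Data.List.Membership.Propositional using (_∈_)
open import Data.Maybe using (Maybe; just; nothing)
open import Data.Product using (Σ; _×_; ∃; ∃-syntax)
open import Relation.Nullary.Decidable using (⌊_⌋)
open import Relation.Binary.PropositionalEquality using (_≡_)
open import Function.Bundles using (_⤖_; _⇔_; Bijection)
open import Function.Definitions using (Injective)
import Data.Nat as ℕ

-- Vertices of the cycle C_n are Fin n; the underlying (undirected) cycle has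
-- the edges {i , next i}, where next i = i + 1 mod n.
next : ∀ {n} .{{_ : NonZero n}} → Fin n → Fin n
next {n} i = fromℕ< (m%n<n (suc (toℕ i)) n)

-- An orientation of C_n: for each edge {i , next i}, o i = true means the arc
-- is (i , next i), o i = false means the arc is (next i , i).
Orientation : ℕ → Set
Orientation n = Fin n → Bool

arc : ∀ {n} .{{_ : NonZero n}} → Orientation n → Fin n → Fin n → Bool
arc o u v = (o u ∧ ⌊ v ≟ next u ⌋) ∨ (not (o v) ∧ ⌊ u ≟ next v ⌋)

Arc : ∀ {n} .{{_ : NonZero n}} → Orientation n → Fin n → Fin n → Set
Arc o u v = arc o u v ≡ true

walk : ∀ {n} .{{_ : NonZero n}} → Orientation n → ℕ → Fin n → Fin n → Bool
walk o zero    u y = ⌊ u ≟ y ⌋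
walk {n} o (suc k) u y = any (λ x → arc o u x ∧ walk o k x y) (allFin n)

search : ∀ {n} .{{_ : NonZero n}} → Orientation n → ℕ → ℕ → Fin n → Fin n → Maybe ℕ
search o zero       start u y = nothing
search o (suc fuel) start u y =
  if walk o start u y then just start else search o fuel (suc start) u y

-- d(u , y): length of a shortest directed path from u to y (just k), or
-- nothing (= ∞) if there is none.  A shortest walk is a path, and a path in a
-- digraph on n vertices has at most n - 1 arcs, so lengths 0 .. n-1 suffice.
dist : ∀ {n} .{{_ : NonZero n}} → Orientation n → Fin n → Fin n → Maybe ℕ
dist {n} o u y = search o n 0 u y

_∈ᵇ_ : ℕ → List ℕ → Bool
k ∈ᵇ D = any (λ j → ⌊ k ℕ.≟ j ⌋) D

inDᵇ : List ℕ → Maybe ℕ → Bool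
inDᵇ D (just k) = k ∈ᵇ D
inDᵇ D nothing  = false

inN : ∀ {n} .{{_ : NonZero n}} → Orientation n → List ℕ → Fin n → Fin n → Bool
inN o D v y = inDᵇ D (dist o v y)

-- label of a vertex under a bijection f : V → {1,…,n} (encoded via Fin n, +1)
label : ∀ {n} → (Fin n ⤖ Fin n) → Fin n → ℕ
label f y = suc (toℕ (Bijection.to f y))

weight : ∀ {n} .{{_ : NonZero n}} → Orientation n → List ℕ → (Fin n ⤖ Fin n) → Fin n → ℕ
weight {n} o D f v =
  sum (map (λ y → if inN o D v y then label f y else 0) (allFin n))

IsDAntimagicLabeling : ∀ {n} .{{_ : NonZero n}} → Orientation n → List ℕ → (Fin n ⤖ Fin n) → Set
IsDAntimagicLabeling o D f = Injective _≡_ _≡_ (weight o D f)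

DAntimagic : ∀ {n} .{{_ : NonZero n}} → Orientation n → List ℕ → Set
DAntimagic {n} o D = Σ (Fin n ⤖ Fin n) (λ f → IsDAntimagicLabeling o D f)

FiniteDistances : ∀ {n} .{{_ : NonZero n}} → Orientation n → List ℕ → Set
FiniteDistances {n} o D = All (λ k → ∃[ u ] ∃[ v ] (dist o u v ≡ just k)) D

Unidirectional : ∀ {n} .{{_ : NonZero n}} → Orientation n → Set
Unidirectional {n} o =
  Σ (Fin n ⤖ Fin n) λ σ →
    ∀ u v → Arc o u v ⇔ (∃[ i ] (u ≡ Bijection.to σ i × v ≡ Bijection.to σ (next i)))

module Submission where

-- Record the orientation of the edge {k , k+1} as a bit forward k (true: the
-- arc is k → k+1).  If the bits are constant the cycle is unidirectional.
-- Otherwise some k has forward k and not forward (k+1), which makes k+1 a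
-- sink.  Call a vertex a near-sink if all its out-neighbours are sinks: it
-- starts no walk with two or more arcs, so when min D ≥ 2 its D-neighbourhood
-- is empty and its weight is 0.  Looking at the two edges on either side of a
-- sink (and, if need be, at the next place where the bits switch from true to
-- false) yields two distinct near-sinks as soon as n ≥ 3; two vertices of
-- weight 0 contradict D-antimagicness.

open import Defs
open import Data.Nat using (ℕ; zero; suc; _+_; _*_; _∸_; _≤_; _<_; z≤n; s≤s; NonZero)
import Data.Nat as ℕ
open import Data.Nat.Properties hiding (_≟_)
open import Data.Nat.DivMod
open import Data.Fin using (Fin; toℕ; fromℕ<; _≟_; opposite)
open import Data.Fin.Properties
  using (toℕ-fromℕ<; toℕ-injective; toℕ<n; opposite-prop; opposite-involutive; all?; ¬∀⟶∃¬)
open import Data.Fin.Permutation using (reverse)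
open import Data.Bool using (Bool; true; false; _∧_; if_then_else_)
import Data.Bool as Bool
open import Data.Bool.Properties using (¬-not; not-¬; ∨-zeroʳ)
open import Data.List using (List; []; _∷_; allFin; map)
open import Data.Bool.ListAction using (any)
open import Data.Nat.ListAction using (sum)
open import Data.List.Relation.Unary.All using (All; []; _∷_)
open import Data.Maybe using (just; nothing)
open import Data.Product using (_×_; _,_; ∃-syntax; ∃₂)
open import Data.Sum using (_⊎_; inj₁; inj₂; [_,_])
open import Relation.Binary.PropositionalEquality hiding ([_])
open import Relation.Binary.Definitions using (tri<; tri≈; tri>)
open import Relation.Nullary using (yes; no; contradiction)
open import Function.Base using (_∘_)
open import Function.Bundles using (mk⇔)
open import Function.Properties.Inverse using (↔⇒⤖)
open import Function.Construct.Identity using (⤖-id)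

m<o<m+n⇒m%n≢o%n : ∀ {m n o} .{{_ : NonZero n}} → m < o → o < m + n → m % n ≢ o % n
m<o<m+n⇒m%n≢o%n {m} {n} {o} m<o o<m+n m%n≡o%n = <-irrefl refl (<-≤-trans o<m+n m+n≤o)
  where
  open ≤-Reasoning
  r : ℕ
  r = o % n
  m≡ : m ≡ r + (m / n) * n
  m≡ = trans (m≡m%n+[m/n]*n m n) (cong (_+ (m / n) * n) m%n≡o%n)
  o≡ : o ≡ r + (o / n) * n
  o≡ = m≡m%n+[m/n]*n o n
  m/n<o/n : m / n < o / n
  m/n<o/n = *-cancelʳ-< n (m / n) (o / n) (+-cancelˡ-< r _ _ (subst₂ _<_ m≡ o≡ m<o))
  m+n≤o : m + n ≤ o
  m+n≤o = begin
    m + n                 ≡⟨ cong (_+ n) m≡ ⟩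
    r + (m / n) * n + n   ≡⟨ +-assoc r _ n ⟩
    r + ((m / n) * n + n) ≡⟨ cong (r +_) (+-comm ((m / n) * n) n) ⟩
    r + suc (m / n) * n   ≤⟨ +-monoʳ-≤ r (*-monoˡ-≤ n m/n<o/n) ⟩
    r + (o / n) * n       ≡⟨ o≡ ⟨
    o                     ∎

any-false : ∀ {A : Set} (p : A → Bool) → (∀ x → p x ≡ false) → ∀ xs → any p xs ≡ false
any-false p p≡false []       = refl
any-false p p≡false (x ∷ xs) rewrite p≡false x = any-false p p≡false xs

sum-map-zero : ∀ {A : Set} (f : A → ℕ) → (∀ x → f x ≡ 0) → ∀ xs → sum (map f xs) ≡ 0
sum-map-zero f f≡0 []       = refl
sum-map-zero f f≡0 (x ∷ xs) rewrite f≡0 x = sum-map-zero f f≡0 xs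

∈ᵇ-below-min : ∀ {k l} (D : List ℕ) → k < l → All (l ≤_) D → k ∈ᵇ D ≡ false
∈ᵇ-below-min []      k<l []          = refl
∈ᵇ-below-min {k} (j ∷ D) k<l (l≤j ∷ l≤D) with k ℕ.≟ j
... | yes refl = contradiction (<-≤-trans k<l l≤j) (<-irrefl refl)
... | no _     = ∈ᵇ-below-min D k<l l≤D

search-sound : ∀ {n} .{{_ : NonZero n}} (o : Orientation n) fuel start u y {k} →
               search o fuel start u y ≡ just k → walk o k u y ≡ true
search-sound o (suc fuel) start u y eq with walk o start u y in w
search-sound o (suc fuel) start u y refl | true  = w
search-sound o (suc fuel) start u y eq   | false = search-sound o fuel (suc start) u y eq

constant-or-switching : ∀ {n} (b : Fin n → Bool) →
                        (∀ i → b i ≡ true) ⊎ (∀ i → b i ≡ false) ⊎ ∃₂ λ i j → b i ≡ false × b j ≡ true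
constant-or-switching {n} b with all? (λ i → b i Bool.≟ true) | all? (λ i → b i Bool.≟ false)
... | yes all-true | _             = inj₁ all-true
... | no _         | yes all-false = inj₂ (inj₁ all-false)
... | no ¬all-true | no ¬all-false with ¬∀⟶∃¬ n _ (λ i → b i Bool.≟ true) ¬all-true
                                      | ¬∀⟶∃¬ n _ (λ i → b i Bool.≟ false) ¬all-false
... | i , bi≢true | j , bj≢false = inj₂ (inj₂ (i , j , ¬-not bi≢true , ¬-not bj≢false))

module CycleIndexing {n : ℕ} .{{_ : NonZero n}} where

  vertex : ℕ → Fin n
  vertex k = fromℕ< (m%n<n k n)

  toℕ-vertex : ∀ k → toℕ (vertex k) ≡ k % n
  toℕ-vertex k = toℕ-fromℕ< (m%n<n k n)

  vertex-cong : ∀ {k l} → k % n ≡ l % n → vertex k ≡ vertex l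
  vertex-cong {k} {l} eq = toℕ-injective (trans (toℕ-vertex k) (trans eq (sym (toℕ-vertex l))))

  vertex-toℕ : ∀ x → vertex (toℕ x) ≡ x
  vertex-toℕ x = toℕ-injective (trans (toℕ-vertex (toℕ x)) (m<n⇒m%n≡m (toℕ<n x)))

  vertex-periodic : ∀ k → vertex (k + n) ≡ vertex k
  vertex-periodic k = vertex-cong ([m+n]%n≡m%n k n)

  vertex-distinct : ∀ {k l} → k < l → l < k + n → vertex k ≢ vertex l
  vertex-distinct {k} {l} k<l l<k+n eq = m<o<m+n⇒m%n≢o%n k<l l<k+n
    (trans (sym (toℕ-vertex k)) (trans (cong toℕ eq) (toℕ-vertex l)))

  next-vertex : ∀ k → next (vertex k) ≡ vertex (suc k)
  next-vertex k = vertex-cong (begin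
    suc (toℕ (vertex k)) % n     ≡⟨ cong (λ r → suc r % n) (toℕ-vertex k) ⟩
    suc (k % n) % n              ≡⟨ %-distribˡ-+ 1 (k % n) n ⟩
    (1 % n + k % n % n) % n      ≡⟨ cong (λ r → (1 % n + r) % n) (m%n%n≡m%n k n) ⟩
    (1 % n + k % n) % n          ≡⟨ %-distribˡ-+ 1 k n ⟨
    suc k % n                    ∎)
    where open ≡-Reasoning

  next-injective : ∀ {x y} → next x ≡ next y → x ≡ y
  next-injective {x} {y} eq with <-cmp (toℕ x) (toℕ y)
  ... | tri≈ _ x≡y _ = toℕ-injective x≡y
  ... | tri< x<y _ _ = contradiction eq (vertex-distinct (s≤s x<y) (s≤s (<-≤-trans (toℕ<n y) (m≤n+m n _))))
  ... | tri> _ _ y<x = contradiction (sym eq) (vertex-distinct (s≤s y<x) (s≤s (<-≤-trans (toℕ<n x) (m≤n+m n _))))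

  vertex-suc-distinct : 2 ≤ n → ∀ k → vertex k ≢ vertex (suc k)
  vertex-suc-distinct n≥2 k = vertex-distinct (n<1+n k) (subst (_< k + n) (+-comm k 1) (+-monoʳ-< k n≥2))

  next-opposite-next : ∀ i → next (opposite (next i)) ≡ opposite i
  next-opposite-next i = toℕ-injective (begin
    toℕ (next (opposite (next i)))    ≡⟨ toℕ-vertex _ ⟩
    suc (toℕ (opposite (next i))) % n ≡⟨ cong (λ r → suc r % n) (opposite-prop (next i)) ⟩
    suc (n ∸ suc (toℕ (next i))) % n  ≡⟨ cong (λ r → suc (n ∸ suc r) % n) (toℕ-vertex _) ⟩
    suc (n ∸ suc (suc t % n)) % n     ≡⟨ wrap (m≤n⇒m<n∨m≡n (toℕ<n i)) ⟩
    n ∸ suc t                         ≡⟨ opposite-prop i ⟨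
    toℕ (opposite i)                  ∎)
    where
    open ≡-Reasoning
    t : ℕ
    t = toℕ i
    wrap : suc t < n ⊎ suc t ≡ n → suc (n ∸ suc (suc t % n)) % n ≡ n ∸ suc t
    wrap (inj₁ t+1<n) rewrite m<n⇒m%n≡m t+1<n | sym (+-∸-assoc 1 t+1<n) =
      m<n⇒m%n≡m (∸-monoʳ-< {n} {suc t} {0} (s≤s z≤n) (<⇒≤ t+1<n))
    wrap (inj₂ t+1≡n) rewrite trans (cong (_% n) t+1≡n) (n%n≡0 n)
                            | sym (+-∸-assoc 1 {n} {1} (subst (1 ≤_) t+1≡n (s≤s z≤n)))
                            | trans (cong (n ∸_) t+1≡n) (n∸n≡0 n) = n%n≡0 n

module OrientedCycle {n : ℕ} .{{_ : NonZero n}} (o : Orientation n) where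
  open CycleIndexing {n}

  forward : ℕ → Bool
  forward k = o (vertex k)

  forward-periodic : ∀ k → forward (k + n) ≡ forward k
  forward-periodic k = cong o (vertex-periodic k)

  Sink : Fin n → Set
  Sink v = ∀ x → arc o v x ≡ false

  NearSink : Fin n → Set
  NearSink v = ∀ x → Arc o v x → Sink x

  sink⇒nearSink : ∀ {v} → Sink v → NearSink v
  sink⇒nearSink v-sink x v→x = contradiction (trans (sym (v-sink x)) v→x) λ ()

  arc-cases : ∀ {u x} → Arc o u x → (o u ≡ true × x ≡ next u) ⊎ (o x ≡ false × u ≡ next x)
  arc-cases {u} {x} u→x with o u | x ≟ next u | o x | u ≟ next x
  arc-cases _   | true  | yes x≡ | _     | _      = inj₁ (refl , x≡)
  arc-cases _   | true  | no _   | false | yes u≡ = inj₂ (refl , u≡)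
  arc-cases _   | false | _      | false | yes u≡ = inj₂ (refl , u≡)
  arc-cases ()  | true  | no _   | true  | _
  arc-cases ()  | true  | no _   | false | no _
  arc-cases ()  | false | _      | true  | _
  arc-cases ()  | false | _      | false | no _

  arc-forward : ∀ {u} → o u ≡ true → Arc o u (next u)
  arc-forward {u} ou with next u ≟ next u
  ... | yes _ rewrite ou = refl
  ... | no ¬refl = contradiction refl ¬refl

  arc-backward : ∀ {v} → o v ≡ false → Arc o (next v) v
  arc-backward {v} ov with next v ≟ next v
  ... | yes _ rewrite ov = ∨-zeroʳ _
  ... | no ¬refl = contradiction refl ¬refl

  arc-from-vertex : ∀ k {x} → Arc o (vertex (suc k)) x →
                    (forward (suc k) ≡ true × x ≡ vertex (suc (suc k))) ⊎ (forward k ≡ false × x ≡ vertex k)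
  arc-from-vertex k {x} u→x with arc-cases u→x
  ... | inj₁ (fk+1 , x≡) = inj₁ (fk+1 , trans x≡ (next-vertex (suc k)))
  ... | inj₂ (ox , u≡) = inj₂ (trans (cong o (sym x≡)) ox , x≡)
    where
    x≡ : x ≡ vertex k
    x≡ = next-injective (trans (sym u≡) (sym (next-vertex k)))

  sink-at-descent : ∀ j → forward j ≡ true → forward (suc j) ≡ false → Sink (vertex (suc j))
  sink-at-descent j fj fj+1 x =
    ¬-not ([ (λ (fj+1′ , _) → not-¬ fj+1′ fj+1) , (λ (fj′ , _) → not-¬ fj fj′) ] ∘ arc-from-vertex j)

  nearSink-before-descent : ∀ m → forward m ≡ true → forward (suc m) ≡ true →
                            forward (suc (suc m)) ≡ false → NearSink (vertex (suc m))
  nearSink-before-descent m fm fm+1 fm+2 x u→x with arc-from-vertex m u→x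
  ... | inj₁ (_ , refl) = sink-at-descent (suc m) fm+1 fm+2
  ... | inj₂ (fm′ , _)  = contradiction fm′ (not-¬ fm)

  nearSink-after-descent : ∀ m → forward (suc m) ≡ true → forward (suc (suc m)) ≡ false →
                           forward (suc (suc (suc m))) ≡ false → NearSink (vertex (suc (suc (suc m))))
  nearSink-after-descent m fm+1 fm+2 fm+3 x u→x with arc-from-vertex (suc (suc m)) u→x
  ... | inj₁ (fm+3′ , _) = contradiction fm+3 (not-¬ fm+3′)
  ... | inj₂ (_ , refl)  = sink-at-descent (suc m) fm+1 fm+2

  walk-from-sink : ∀ {v} → Sink v → ∀ k y → walk o (suc k) v y ≡ false
  walk-from-sink v-sink k y = any-false _ (λ x → cong (_∧ walk o k x y) (v-sink x)) (allFin n)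

  walk-from-nearSink : ∀ {v} → NearSink v → ∀ k y → walk o (suc (suc k)) v y ≡ false
  walk-from-nearSink {v} v-near k y = any-false _ step (allFin n)
    where
    step : ∀ x → (arc o v x ∧ walk o (suc k) x y) ≡ false
    step x with arc o v x in v→x
    ... | false = refl
    ... | true  = walk-from-sink (v-near x v→x) k y

  dist-from-nearSink : ∀ {v y k} → NearSink v → dist o v y ≡ just k → k < 2
  dist-from-nearSink {k = zero}     _ _ = s≤s z≤n
  dist-from-nearSink {k = suc zero} _ _ = s≤s (s≤s z≤n)
  dist-from-nearSink {v} {y} {suc (suc k)} v-near eq =
    contradiction (trans (sym (search-sound o n 0 v y eq)) (walk-from-nearSink v-near k y)) λ ()

  weight-nearSink : ∀ {D} f {v} → All (2 ≤_) D → NearSink v → weight o D f v ≡ 0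
  weight-nearSink {D} f {v} D≥2 v-near = sum-map-zero _ unlabelled (allFin n)
    where
    outside : ∀ y → inN o D v y ≡ false
    outside y with dist o v y in eq
    ... | nothing = refl
    ... | just k  = ∈ᵇ-below-min D (dist-from-nearSink v-near eq) D≥2
    unlabelled : ∀ y → (if inN o D v y then label f y else 0) ≡ 0
    unlabelled y rewrite outside y = refl

  antimagic⇒nearSink-unique : ∀ {D} → All (2 ≤_) D → DAntimagic o D →
                              ∀ {v w} → NearSink v → NearSink w → v ≡ w
  antimagic⇒nearSink-unique D≥2 (f , weight-injective) v-near w-near =
    weight-injective (trans (weight-nearSink f D≥2 v-near) (sym (weight-nearSink f D≥2 w-near)))

  descent : ∀ {a} c → a < c → forward a ≡ true → forward c ≡ false →
            ∃[ j ] (a ≤ j × j < c × forward j ≡ true × forward (suc j) ≡ false)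
  descent (suc c) (s≤s a≤c) fa fc+1 with forward c in fc
  ... | true  = c , a≤c , ≤-refl , fc , fc+1
  ... | false with m≤n⇒m<n∨m≡n a≤c
  ...   | inj₂ refl = contradiction fc (not-¬ fa)
  ...   | inj₁ a<c with descent c a<c fa fc
  ...     | j , a≤j , j<c , fj , fj+1 = j , a≤j , m<n⇒m<1+n j<c , fj , fj+1

  TwoNearSinks : Set
  TwoNearSinks = ∃₂ λ v w → v ≢ w × NearSink v × NearSink w

  twoNearSinks-around-sink : 3 ≤ n → ∀ m → forward (suc m) ≡ true → forward (suc (suc m)) ≡ false →
                             TwoNearSinks
  twoNearSinks-around-sink n≥3 m fm+1 fm+2 with forward m in fm | forward (3 + m) in fm+3
  ... | true  | _     = _ , _ , vertex-suc-distinct (≤-trans (n≤1+n 2) n≥3) (suc m) ,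
                        nearSink-before-descent m fm fm+1 fm+2 , sink⇒nearSink (sink-at-descent (suc m) fm+1 fm+2)
  ... | false | false = _ , _ , vertex-suc-distinct (≤-trans (n≤1+n 2) n≥3) (suc (suc m)) ,
                        sink⇒nearSink (sink-at-descent (suc m) fm+1 fm+2) , nearSink-after-descent m fm+1 fm+2 fm+3
  -- forward is true at m+3 but false at m+n ≡ m, so (with n > 3) it drops
  -- to false somewhere in between, at a second sink.
  ... | false | true with m≤n⇒m<n∨m≡n n≥3
  ...   | inj₂ refl = contradiction fm (not-¬ (trans (sym (forward-periodic m)) (subst (λ k → forward k ≡ true) (+-comm 3 m) fm+3)))
  ...   | inj₁ n>3 with descent (m + n) (subst (_< m + n) (+-comm m 3) (+-monoʳ-< m n>3)) fm+3 (trans (forward-periodic m) fm)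
  ...     | j , 3+m≤j , j<m+n , fj , fj+1 =
    _ , _ , vertex-distinct (s≤s (≤-trans (n≤1+n _) 3+m≤j)) (s≤s (s≤s (<⇒≤ j<m+n))) ,
    sink⇒nearSink (sink-at-descent (suc m) fm+1 fm+2) , sink⇒nearSink (sink-at-descent j fj fj+1)

  mixed⇒twoNearSinks : 3 ≤ n → ∀ {a c} → o a ≡ false → o c ≡ true → TwoNearSinks
  -- The shift by n makes the descent point positive, so its predecessor exists in ℕ.
  mixed⇒twoNearSinks n≥3 {a} {c} oa oc with descent (toℕ a + n + n) c+n<a+2n fc+n fa+2n
    where
    c+n<a+2n : toℕ c + n < toℕ a + n + n
    c+n<a+2n = +-monoˡ-< n (<-≤-trans (toℕ<n c) (m≤n+m n (toℕ a)))
    fc+n : forward (toℕ c + n) ≡ true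
    fc+n = trans (forward-periodic (toℕ c)) (trans (cong o (vertex-toℕ c)) oc)
    fa+2n : forward (toℕ a + n + n) ≡ false
    fa+2n = trans (forward-periodic (toℕ a + n)) (trans (forward-periodic (toℕ a)) (trans (cong o (vertex-toℕ a)) oa))
  ... | zero  , c+n≤0 , _ = contradiction (≤-trans n≥3 (≤-trans (m≤n+m n (toℕ c)) c+n≤0)) λ ()
  ... | suc m , _ , _ , fm+1 , fm+2 = twoNearSinks-around-sink n≥3 m fm+1 fm+2

  allForward⇒unidirectional : (∀ i → o i ≡ true) → Unidirectional o
  allForward⇒unidirectional all-true = ⤖-id (Fin n) , λ u v → mk⇔ (to u v) from
    where
    to : ∀ u v → Arc o u v → ∃[ i ] (u ≡ i × v ≡ next i)
    to u v u→v with arc-cases u→v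
    ... | inj₁ (_ , v≡) = u , refl , v≡
    ... | inj₂ (ov , _) = contradiction ov (not-¬ (all-true v))
    from : ∀ {u v} → ∃[ i ] (u ≡ i × v ≡ next i) → Arc o u v
    from (i , refl , refl) = arc-forward (all-true i)

  allBackward⇒unidirectional : (∀ i → o i ≡ false) → Unidirectional o
  allBackward⇒unidirectional all-false = ↔⇒⤖ reverse , λ u v → mk⇔ (to u v) from
    where
    to : ∀ u v → Arc o u v → ∃[ i ] (u ≡ opposite i × v ≡ opposite (next i))
    to u v u→v with arc-cases u→v
    ... | inj₁ (ou , _) = contradiction ou (not-¬ (all-false u))
    ... | inj₂ (_ , u≡) = opposite u , sym (opposite-involutive u) , next-injective (begin
      next v                                       ≡⟨ u≡ ⟨
      u                                            ≡⟨ opposite-involutive u ⟨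
      opposite (opposite u)                        ≡⟨ next-opposite-next (opposite u) ⟨
      next (opposite (next (opposite u)))          ∎)
      where open ≡-Reasoning
    from : ∀ {u v} → ∃[ i ] (u ≡ opposite i × v ≡ opposite (next i)) → Arc o u v
    from (i , refl , refl) =
      subst (λ u → Arc o u (opposite (next i))) (next-opposite-next i) (arc-backward (all-false _))

open OrientedCycle
  using (allForward⇒unidirectional; allBackward⇒unidirectional; mixed⇒twoNearSinks; antimagic⇒nearSink-unique)

mainTheorem11 : (n : ℕ) .{{_ : NonZero n}} → 3 ≤ n →
                (o : Orientation n) (D : List ℕ) →
                D ≢ [] → FiniteDistances o D → All (2 ≤_) D →
                DAntimagic o D → Unidirectional o
mainTheorem11 n n≥3 o D _ _ D≥2 antimagic with constant-or-switching o
... | inj₁ all-true             = allForward⇒unidirectional o all-true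
... | inj₂ (inj₁ all-false)    = allBackward⇒unidirectional o all-false
... | inj₂ (inj₂ (_ , _ , oa , oc)) with mixed⇒twoNearSinks o n≥3 oa oc
... | _ , _ , v≢w , v-near , w-near =
  contradiction (antimagic⇒nearSink-unique o D≥2 antimagic v-near w-near) v≢w
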